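{- Let $m=6j-1$ be a prime, where $j$ is a positive integer. Then for every integer $n\geq 0$ such that $m \mid p(n,3)$, and for every $i\in\{0,1,\ldots,m-1\}$, $$\#\{\lambda\in P(n,3) : \lambda_1-\lambda_3\equiv i \pmod m\} = \frac{p(n,3)}{m}.$$ That is, the statistic $c_{LS}(\lambda)=\lambda_1-\lambda_3 \bmod m$ (largest part minus smallest part modulo $m$) is a supercrank for partitions into three parts modulo $m$.
   Context: For an integer $n\ge 0$, $P(n,3)$ denotes the set of partitions of $n$ into exactly three parts, identified with integer vectors $\lambda=(\lambda_1,\lambda_2,\lambda_3)\in\mathbb{Z}^3$ with $\lambda_1+\lambda_2+\lambda_3=n$ and $\lambda_1\geq\lambda_2\geq\lambda_3>0$; $p(n,3)=\#P(n,3)$. A function $c$ defined on $\bigcup_{n\ge0}P(n,3)$ with values in $\{0,\ldots,m-1\}$ is called a supercrank (modulo $m$) if for every $n$ with $m\mid p(n,3)$ all the classes $c^{ -1}(i)\cap P(n,3)$, $i=0,\ldots,m-1$, have the same size. -}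

module Defs where

open import Data.Nat using (ℕ; zero; suc; _+_; _∸_; _≤_; _<_; _≤?_; _<?_; _≟_; NonZero)
open import Data.Nat.DivMod using (_%_)
open import Data.Nat.Properties using ()
open import Data.Product using (_×_; _,_)
open import Data.List using (List; length; filter; upTo; concatMap; map)
open import Relation.Binary.PropositionalEquality using (_≡_)
open import Relation.Nullary using (Dec)
open import Relation.Nullary.Decidable using (_×-dec_)

Triple : Set
Triple = ℕ × ℕ × ℕ

IsPartition3 : ℕ → Triple → Set
IsPartition3 n (a , b , c) = (a + b + c ≡ n) × (b ≤ a) × (c ≤ b) × (0 < c)

isPartition3? : (n : ℕ) → (t : Triple) → Dec (IsPartition3 n t)
isPartition3? n (a , b , c) =
  ((a + b + c) ≟ n) ×-dec ((b ≤? a) ×-dec ((c ≤? b) ×-dec (0 <? c)))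

-- All triples with entries in {0,…,n} (every part of a partition of n is ≤ n).
triplesUpTo : ℕ → List Triple
triplesUpTo n =
  concatMap (λ a → concatMap (λ b → map (λ c → (a , b , c)) (upTo (suc n)))
                             (upTo (suc n)))
            (upTo (suc n))

P3 : ℕ → List Triple
P3 n = filter (isPartition3? n) (triplesUpTo n)

p3 : ℕ → ℕ
p3 n = length (P3 n)

-- The statistic c_LS(λ) = (λ₁ - λ₃) mod m  (λ₁ ≥ λ₃, so natural subtraction is exact).
cLS : (m : ℕ) → .{{_ : NonZero m}} → Triple → ℕ
cLS m (a , b , c) = (a ∸ c) % m

countClass : (m : ℕ) → .{{_ : NonZero m}} → ℕ → ℕ → ℕ
countClass m n i = length (filter (λ t → cLS m t ≟ i) (P3 n))

-- Sort the partitions of n = ρ + 3K (ρ < 3) by their smallest part c = K − u. With r = ρ + 3u,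
-- the values λ₁ − λ₃ that occur are exactly the integers of the window [⌈r/2⌉, r]. Moving from
-- residue class t to t + 1 shifts every window by one, so all m classes have the same size as soon
-- as the left ends ⌈r/2⌉ and the right ends r + 1 of the K windows are equidistributed modulo m.
-- Split by the parity of u, both families are arithmetic progressions of step 3; since m ≡ 2 (mod 3),
-- 3 is invertible mod m and a progression whose length is a multiple of m is equidistributed
-- whatever its start. The closed form of p(n,3) in each class of n modulo 6 shows that m ∣ p(n,3)
-- forces such lengths or starts that agree modulo m, except for n ≡ 3 (mod 6), where
-- p(n,3) = 3q(q+1) + 1 = (q+1)³ − q³ is never divisible by m: cubing is injective modulo a prime m ≡ 2 (mod 3).

module Submission where

open import Defs
open import Data.Nat using (ℕ; suc; _*_; _∸_; _<_; NonZero)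
open import Data.Nat.DivMod using (_/_)
open import Data.Nat.Divisibility using (_∣_)
open import Data.Nat.Primality using (Prime)
open import Relation.Binary.PropositionalEquality using (_≡_)

open import Data.Bool.Base using (Bool; true; false)
open import Data.Empty using (⊥-elim)
open import Data.List.Base using (List; []; _∷_; _++_; length; filter; concatMap; map; applyUpTo; upTo)
open import Data.Nat.Base
open import Data.Nat.Combinatorics using (_C_; nCk+nC[k+1]≡[n+1]C[k+1]; nC1≡n; nCn≡1)
open import Data.Nat.Combinatorics.Specification using (k>n⇒nCk≡0)
open import Data.Nat.DivMod hiding (_mod_)
open import Data.Nat.Divisibility using (divides; _∣0; ∣m∣n⇒∣m+n; ∣m+n∣m⇒∣n; ∣m⇒∣m*n; ∣n⇒∣m*n; ∣⇒≤)
open import Data.Nat.Primality using (euclidsLemma)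
open import Data.Nat.Properties
open import Data.Nat.Tactic.RingSolver using (solve-∀)
open import Data.Product using (_×_; _,_; proj₁; proj₂)
open import Data.Sum using (inj₁; inj₂)
open import Relation.Binary.PropositionalEquality
open import Relation.Nullary using (¬_; does; yes; no)
open import Relation.Nullary.Decidable using (dec-true; dec-false)
open import Relation.Unary using (Pred; Decidable)

-- Finite sums

𝟙 : Bool → ℕ
𝟙 true  = 1
𝟙 false = 0

∑< : ℕ → (ℕ → ℕ) → ℕ
∑< zero    f = 0
∑< (suc n) f = f 0 + ∑< n (λ x → f (suc x))

syntax ∑< n (λ x → e) = ∑[ x < n ] e

∑-cong : ∀ n {f g : ℕ → ℕ} → (∀ x → x < n → f x ≡ g x) → ∑< n f ≡ ∑< n g
∑-cong zero    f≡g = refl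
∑-cong (suc n) f≡g = cong₂ _+_ (f≡g 0 z<s) (∑-cong n (λ x x<n → f≡g (suc x) (s<s x<n)))

∑-split : ∀ A B (f : ℕ → ℕ) → ∑< (A + B) f ≡ ∑< A f + ∑[ y < B ] f (A + y)
∑-split zero    B f = refl
∑-split (suc A) B f =
  trans (cong (f 0 +_) (∑-split A B (λ x → f (suc x)))) (sym (+-assoc (f 0) _ _))

∑-last : ∀ n (f : ℕ → ℕ) → ∑< (suc n) f ≡ ∑< n f + f n
∑-last n f = begin
  ∑< (suc n) f               ≡⟨ cong (λ k → ∑< k f) (+-comm 1 n) ⟩
  ∑< (n + 1) f               ≡⟨ ∑-split n 1 f ⟩
  ∑< n f + (f (n + 0) + 0)   ≡⟨ cong (λ x → ∑< n f + x) (trans (+-identityʳ _) (cong f (+-identityʳ n))) ⟩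
  ∑< n f + f n               ∎
  where open ≡-Reasoning

∑-const : ∀ n a → ∑[ _ < n ] a ≡ n * a
∑-const zero    a = refl
∑-const (suc n) a = cong (a +_) (∑-const n a)

∑-vanish : ∀ n {f : ℕ → ℕ} → (∀ x → x < n → f x ≡ 0) → ∑< n f ≡ 0
∑-vanish n f≡0 = trans (∑-cong n f≡0) (trans (∑-const n 0) (*-zeroʳ n))

∑-distrib-+ : ∀ n (f g : ℕ → ℕ) → ∑[ x < n ] (f x + g x) ≡ ∑< n f + ∑< n g
∑-distrib-+ zero    f g = refl
∑-distrib-+ (suc n) f g =
  trans (cong (f 0 + g 0 +_) (∑-distrib-+ n _ _)) (+-+-comm (f 0) (g 0) _ _)
  where
  +-+-comm : ∀ a b c d → a + b + (c + d) ≡ a + c + (b + d)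
  +-+-comm = solve-∀

∑-distribˡ-* : ∀ n a (f : ℕ → ℕ) → ∑[ x < n ] (a * f x) ≡ a * ∑< n f
∑-distribˡ-* zero    a f = sym (*-zeroʳ a)
∑-distribˡ-* (suc n) a f =
  trans (cong (a * f 0 +_) (∑-distribˡ-* n a _)) (sym (*-distribˡ-+ a (f 0) _))

∑-comm : ∀ A B (f : ℕ → ℕ → ℕ) → ∑[ x < A ] ∑[ y < B ] f x y ≡ ∑[ y < B ] ∑[ x < A ] f x y
∑-comm zero    B f = sym (∑-vanish B (λ _ _ → refl))
∑-comm (suc A) B f = trans (cong (∑< B (f 0) +_) (∑-comm A B (λ x → f (suc x))))
  (sym (∑-distrib-+ B (f 0) (λ y → ∑[ x < A ] f (suc x) y)))

∑-reverse : ∀ n (f : ℕ → ℕ) → ∑< n f ≡ ∑[ u < n ] f (n ∸ suc u)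
∑-reverse zero    f = refl
∑-reverse (suc n) f = begin
  f 0 + ∑[ x < n ] f (suc x)                ≡⟨ cong (f 0 +_) (∑-reverse n (λ x → f (suc x))) ⟩
  f 0 + ∑[ u < n ] f (suc (n ∸ suc u))      ≡⟨ cong (f 0 +_) (∑-cong n (λ u u<n → cong f (sym (+-∸-assoc 1 u<n)))) ⟩
  f 0 + ∑[ u < n ] f (suc n ∸ suc u)        ≡⟨ +-comm (f 0) _ ⟩
  ∑[ u < n ] f (suc n ∸ suc u) + f 0        ≡⟨ cong (λ x → ∑[ u < n ] f (suc n ∸ suc u) + f x) (sym (n∸n≡0 n)) ⟩
  ∑[ u < n ] f (suc n ∸ suc u) + f (n ∸ n)  ≡⟨ sym (∑-last n _) ⟩
  ∑[ u < suc n ] f (suc n ∸ suc u)          ∎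
  where open ≡-Reasoning

∑-support : ∀ N lo len (f : ℕ → ℕ) → lo + len ≤ N →
  (∀ x → x < lo → f x ≡ 0) → (∀ x → lo + len ≤ x → x < N → f x ≡ 0) →
  ∑< N f ≡ ∑[ k < len ] f (lo + k)
∑-support N lo len f hi≤N below above = begin
  ∑< N f                                                  ≡⟨ cong (λ k → ∑< k f) (sym (m+[n∸m]≡n hi≤N)) ⟩
  ∑< (lo + len + rest) f                                  ≡⟨ ∑-split (lo + len) rest f ⟩
  ∑< (lo + len) f + ∑[ y < rest ] f (lo + len + y)        ≡⟨ cong₂ _+_ (∑-split lo len f) (∑-vanish rest outside) ⟩
  ∑< lo f + ∑[ k < len ] f (lo + k) + 0                   ≡⟨ cong (λ s → s + ∑[ k < len ] f (lo + k) + 0) (∑-vanish lo below) ⟩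
  ∑[ k < len ] f (lo + k) + 0                             ≡⟨ +-identityʳ _ ⟩
  ∑[ k < len ] f (lo + k)                                 ∎
  where
  open ≡-Reasoning
  rest = N ∸ (lo + len)
  outside : ∀ y → y < rest → f (lo + len + y) ≡ 0
  outside y y<rest = above _ (m≤m+n _ y)
    (subst (lo + len + y <_) (m+[n∸m]≡n hi≤N) (+-monoʳ-< (lo + len) y<rest))

∑-unique : ∀ N k (f : ℕ → ℕ) → k < N → (∀ x → x < N → x ≢ k → f x ≡ 0) → ∑< N f ≡ f k
∑-unique N k f k<N others = trans
  (∑-support N k 1 f (subst (_≤ N) (+-comm 1 k) k<N)
    (λ x x<k → others x (<-trans x<k k<N) (<⇒≢ x<k))
    (λ x k<x x<N → others x x<N (≢-sym (<⇒≢ (subst (_≤ x) (+-comm k 1) k<x)))))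
  (trans (+-identityʳ _) (cong f (+-identityʳ k)))

∑-divisible : ∀ {d} n (f : ℕ → ℕ) → (∀ x → x < n → d ∣ f x) → d ∣ ∑< n f
∑-divisible zero    f d∣f = _ ∣0
∑-divisible (suc n) f d∣f =
  ∣m∣n⇒∣m+n (d∣f 0 z<s) (∑-divisible n (λ x → f (suc x)) (λ x x<n → d∣f (suc x) (s<s x<n)))

∑-even : ∀ q (f : ℕ → ℕ) → ∑< (2 * q) f ≡ ∑[ l < q ] f (2 * l) + ∑[ l < q ] f (1 + 2 * l)
∑-even zero    f = refl
∑-even (suc q) f = begin
  ∑< (2 * suc q) f                          ≡⟨ cong (λ k → ∑< k f) (*-suc 2 q) ⟩
  f 0 + (f 1 + ∑[ x < 2 * q ] f (2 + x))    ≡⟨ cong (λ s → f 0 + (f 1 + s)) (∑-even q (λ x → f (2 + x))) ⟩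
  f 0 + (f 1 + (E + O))                     ≡⟨ +-interchange (f 0) (f 1) E O ⟩
  (f 0 + E) + (f 1 + O)                     ≡⟨ cong₂ (λ s t → (f 0 + s) + (f 1 + t)) (∑-cong q (λ l _ → cong f (sym (*-suc 2 l))))
                                                                                   (∑-cong q (λ l _ → cong (λ x → f (suc x)) (sym (*-suc 2 l)))) ⟩
  ∑[ l < suc q ] f (2 * l) + ∑[ l < suc q ] f (1 + 2 * l)  ∎
  where
  open ≡-Reasoning
  E = ∑[ l < q ] f (2 + 2 * l)
  O = ∑[ l < q ] f (3 + 2 * l)
  +-interchange : ∀ a b c d → a + (b + (c + d)) ≡ (a + c) + (b + d)
  +-interchange = solve-∀

∑-parity : ∀ e q (f : ℕ → ℕ) → e < 2 →
  ∑< (e + 2 * q) f ≡ ∑[ l < e + q ] f (2 * l) + ∑[ l < q ] f (1 + 2 * l)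
∑-parity 0 q f _ = ∑-even q f
∑-parity 1 q f _ = begin
  f 0 + ∑[ x < 2 * q ] f (1 + x)                        ≡⟨ cong (f 0 +_) (∑-even q (λ x → f (1 + x))) ⟩
  f 0 + (O + E)                                         ≡⟨ cong (f 0 +_) (+-comm O E) ⟩
  f 0 + (E + O)                                         ≡⟨ sym (+-assoc (f 0) E O) ⟩
  f 0 + E + O                                           ≡⟨ cong (λ s → f 0 + s + O) (∑-cong q (λ l _ → cong f (sym (*-suc 2 l)))) ⟩
  ∑[ l < 1 + q ] f (2 * l) + O                          ∎
  where
  open ≡-Reasoning
  E = ∑[ l < q ] f (2 + 2 * l)
  O = ∑[ l < q ] f (1 + 2 * l)
∑-parity (suc (suc _)) q f (s<s (s<s ()))

∑ˡ : {A : Set} → List A → (A → ℕ) → ℕ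
∑ˡ []       f = 0
∑ˡ (x ∷ xs) f = f x + ∑ˡ xs f

syntax ∑ˡ xs (λ x → e) = ∑[ x ∈ xs ] e

∑ˡ-++ : {A : Set} (xs ys : List A) (f : A → ℕ) → ∑ˡ (xs ++ ys) f ≡ ∑ˡ xs f + ∑ˡ ys f
∑ˡ-++ []       ys f = refl
∑ˡ-++ (x ∷ xs) ys f = trans (cong (f x +_) (∑ˡ-++ xs ys f)) (sym (+-assoc (f x) _ _))

module _ {A B : Set} where

  ∑ˡ-concatMap : ∀ (g : A → List B) xs f → ∑ˡ (concatMap g xs) f ≡ ∑[ x ∈ xs ] ∑ˡ (g x) f
  ∑ˡ-concatMap g []       f = refl
  ∑ˡ-concatMap g (x ∷ xs) f = trans (∑ˡ-++ (g x) _ f) (cong (∑ˡ (g x) f +_) (∑ˡ-concatMap g xs f))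

  ∑ˡ-map : ∀ (g : A → B) xs f → ∑ˡ (map g xs) f ≡ ∑[ x ∈ xs ] f (g x)
  ∑ˡ-map g []       f = refl
  ∑ˡ-map g (x ∷ xs) f = cong (f (g x) +_) (∑ˡ-map g xs f)

∑ˡ-upTo : ∀ n f → ∑ˡ (upTo n) f ≡ ∑< n f
∑ˡ-upTo n f = go n (λ x → x)
  where
  go : ∀ n (h : ℕ → ℕ) → ∑ˡ (applyUpTo h n) f ≡ ∑[ x < n ] f (h x)
  go zero    h = refl
  go (suc n) h = cong (f (h 0) +_) (go n (λ x → h (suc x)))

module _ {A : Set} {p} {P : Pred A p} (P? : Decidable P) where

  ∑ˡ-filter : ∀ xs f → ∑ˡ (filter P? xs) f ≡ ∑[ x ∈ xs ] (𝟙 (does (P? x)) * f x)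
  ∑ˡ-filter []       f = refl
  ∑ˡ-filter (x ∷ xs) f with does (P? x)
  ... | true  = cong₂ _+_ (sym (+-identityʳ (f x))) (∑ˡ-filter xs f)
  ... | false = ∑ˡ-filter xs f

length≡∑ˡ1 : {A : Set} (xs : List A) → length xs ≡ ∑[ _ ∈ xs ] 1
length≡∑ˡ1 []       = refl
length≡∑ˡ1 (x ∷ xs) = cong suc (length≡∑ˡ1 xs)

length-filter : ∀ {A : Set} {p} {P : Pred A p} (P? : Decidable P) (xs : List A) →
  length (filter P? xs) ≡ ∑[ x ∈ xs ] 𝟙 (does (P? x))
length-filter P? []       = refl
length-filter P? (x ∷ xs) with does (P? x)
... | true  = cong suc (length-filter P? xs)
... | false = length-filter P? xs

-- Congruences and Fermat's little theorem

infix 4 _≡_mod_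

_≡_mod_ : ℕ → ℕ → (p : ℕ) → .{{NonZero p}} → Set
x ≡ y mod p = x % p ≡ y % p

module _ {p : ℕ} .{{_ : NonZero p}} where

  +-cong-mod : ∀ {a b c d} → a ≡ b mod p → c ≡ d mod p → a + c ≡ b + d mod p
  +-cong-mod {a} {b} {c} {d} a≡b c≡d =
    trans (%-distribˡ-+ a c p) (trans (cong₂ (λ x y → (x + y) % p) a≡b c≡d) (sym (%-distribˡ-+ b d p)))

  *-cong-mod : ∀ {a b c d} → a ≡ b mod p → c ≡ d mod p → a * c ≡ b * d mod p
  *-cong-mod {a} {b} {c} {d} a≡b c≡d =
    trans (%-distribˡ-* a c p) (trans (cong₂ (λ x y → (x * y) % p) a≡b c≡d) (sym (%-distribˡ-* b d p)))

  ^-cong-mod : ∀ {a b} → a ≡ b mod p → ∀ k → a ^ k ≡ b ^ k mod p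
  ^-cong-mod a≡b zero    = refl
  ^-cong-mod a≡b (suc k) = *-cong-mod a≡b (^-cong-mod a≡b k)

  ≡-mod⇒∣ : ∀ a b → a + b ≡ a mod p → p ∣ b
  ≡-mod⇒∣ a b a+b≡a = ∣m+n∣m⇒∣n (subst (p ∣_) (sym quotients) (divides ((a + b) / p) refl)) (divides (a / p) refl)
    where
    quotients : (a / p) * p + b ≡ ((a + b) / p) * p
    quotients = +-cancelˡ-≡ (a % p) _ _ (begin
      a % p + ((a / p) * p + b)        ≡⟨ +-assoc (a % p) _ b ⟨
      a % p + (a / p) * p + b          ≡⟨ cong (_+ b) (m≡m%n+[m/n]*n a p) ⟨
      a + b                            ≡⟨ m≡m%n+[m/n]*n (a + b) p ⟩
      (a + b) % p + ((a + b) / p) * p  ≡⟨ cong (_+ ((a + b) / p) * p) a+b≡a ⟩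
      a % p + ((a + b) / p) * p        ∎)
      where open ≡-Reasoning

suc-*-C : ∀ n k → suc k * (suc n C suc k) ≡ suc n * (n C k)
suc-*-C zero    zero    = refl
suc-*-C zero    (suc k) = *-zeroʳ (suc (suc k))
suc-*-C (suc n) zero    = trans (+-identityʳ _) (trans (nC1≡n (suc (suc n))) (sym (*-identityʳ _)))
suc-*-C (suc n) (suc k) = begin
  suc (suc k) * (suc (suc n) C suc (suc k))                  ≡⟨ cong (suc (suc k) *_) (sym (pascal (suc n) (suc k))) ⟩
  suc (suc k) * (x + y)                                      ≡⟨ shuffle x y k ⟩
  x + (suc k * x + suc (suc k) * y)                          ≡⟨ cong₂ (λ u v → x + (u + v)) (suc-*-C n k) (suc-*-C n (suc k)) ⟩
  x + (suc n * (n C k) + suc n * (n C suc k))                ≡⟨ cong (_+ (suc n * (n C k) + suc n * (n C suc k))) (sym (pascal n k)) ⟩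
  (n C k + n C suc k) + (suc n * (n C k) + suc n * (n C suc k)) ≡⟨ collect (suc n) (n C k) (n C suc k) ⟩
  suc (suc n) * (n C k + n C suc k)                          ≡⟨ cong (suc (suc n) *_) (pascal n k) ⟩
  suc (suc n) * (suc n C suc k)                              ∎
  where
  open ≡-Reasoning
  pascal = nCk+nC[k+1]≡[n+1]C[k+1]
  x = suc n C suc k
  y = suc n C suc (suc k)
  shuffle : ∀ x y k → suc (suc k) * (x + y) ≡ x + (suc k * x + suc (suc k) * y)
  shuffle = solve-∀
  collect : ∀ n u v → (u + v) + (n * u + n * v) ≡ suc n * (u + v)
  collect = solve-∀

binomial-suc : ∀ a n → suc a ^ n ≡ ∑[ k < suc n ] ((n C k) * a ^ k)
binomial-suc a zero    = refl
binomial-suc a (suc n) = begin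
  suc a ^ n + a * suc a ^ n                            ≡⟨ cong₂ _+_ (binomial-suc a n) (cong (a *_) (binomial-suc a n)) ⟩
  X + a * X                                            ≡⟨ cong₂ _+_ X≡1+Y a*X≡Z ⟩
  (1 + Y) + Z                                          ≡⟨ cong suc (+-comm Y Z) ⟩
  1 + (Z + Y)                                          ≡⟨ cong (λ s → 1 + (Z + s)) Y≡ ⟩
  1 + (Z + ∑[ k < suc n ] ((n C suc k) * a ^ suc k))     ≡⟨ cong suc (sym (∑-distrib-+ (suc n) (λ k → (n C k) * a ^ suc k) (λ k → (n C suc k) * a ^ suc k))) ⟩
  1 + ∑[ k < suc n ] ((n C k) * a ^ suc k + (n C suc k) * a ^ suc k)
                                                       ≡⟨ cong suc (∑-cong (suc n) (λ k _ → trans (sym (*-distribʳ-+ (a ^ suc k) (n C k) _))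
                                                                                          (cong (_* a ^ suc k) (nCk+nC[k+1]≡[n+1]C[k+1] n k)))) ⟩
  1 + ∑[ k < suc n ] ((suc n C suc k) * a ^ suc k)       ∎
  where
  open ≡-Reasoning
  X = ∑[ k < suc n ] ((n C k) * a ^ k)
  Y = ∑[ k < n ] ((n C suc k) * a ^ suc k)
  Z = ∑[ k < suc n ] ((n C k) * a ^ suc k)
  X≡1+Y : X ≡ 1 + Y
  X≡1+Y = cong (_+ Y) (*-identityʳ 1)
  a*X≡Z : a * X ≡ Z
  a*X≡Z = trans (sym (∑-distribˡ-* (suc n) a (λ k → (n C k) * a ^ k))) (∑-cong (suc n) (λ k _ → x*[y*z]≡y*[x*z] a (n C k) (a ^ k)))
    where
    x*[y*z]≡y*[x*z] : ∀ x y z → x * (y * z) ≡ y * (x * z)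
    x*[y*z]≡y*[x*z] = solve-∀
  Y≡ : Y ≡ ∑[ k < suc n ] ((n C suc k) * a ^ suc k)
  Y≡ = sym (trans (∑-last n _) (trans (cong (λ c → Y + c * a ^ suc n) (k>n⇒nCk≡0 (n<1+n n))) (+-identityʳ Y)))

prime∣C : ∀ {p k} → Prime p → 0 < k → k < p → p ∣ p C k
prime∣C {suc p} {suc k} p-prime _ k<p
  with euclidsLemma (suc k) (suc p C suc k) p-prime (divides (p C k) (trans (suc-*-C p k) (*-comm (suc p) _)))
... | inj₁ p∣k = ⊥-elim (<⇒≱ k<p (∣⇒≤ p∣k))
... | inj₂ p∣C = p∣C

fermat : ∀ {p} .{{_ : NonZero p}} → Prime p → ∀ a → a ^ p ≡ a mod p
fermat {suc p} p-prime zero    = refl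
fermat {suc p} p-prime (suc a) = begin
  suc a ^ suc p % suc p                    ≡⟨ cong (_% suc p) (binomial-suc a (suc p)) ⟩
  (1 * 1 + ∑[ k < suc p ] ((suc p C suc k) * a ^ suc k)) % suc p
                                           ≡⟨ cong (λ s → (1 + s) % suc p) (∑-last p (λ k → (suc p C suc k) * a ^ suc k)) ⟩
  (1 + (M + (suc p C suc p) * a ^ suc p)) % suc p
                                           ≡⟨ cong (λ c → (1 + (M + c * a ^ suc p)) % suc p) (nCn≡1 (suc p)) ⟩
  (1 + (M + 1 * a ^ suc p)) % suc p        ≡⟨ cong (_% suc p) (shuffle M (a ^ suc p)) ⟩
  (1 + a ^ suc p + M) % suc p              ≡⟨ %-remove-+ʳ (1 + a ^ suc p) p∣M ⟩
  (1 + a ^ suc p) % suc p                  ≡⟨ +-cong-mod {a = 1} {b = 1} {c = a ^ suc p} {d = a} refl (fermat p-prime a) ⟩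
  suc a % suc p                            ∎
  where
  open ≡-Reasoning
  M = ∑[ k < p ] ((suc p C suc k) * a ^ suc k)
  p∣M : suc p ∣ M
  p∣M = ∑-divisible p _ (λ k k<p → ∣m⇒∣m*n (a ^ suc k) (prime∣C p-prime z<s (s<s k<p)))
  shuffle : ∀ m x → 1 + (m + 1 * x) ≡ 1 + x + m
  shuffle = solve-∀

module _ {p w : ℕ} .{{_ : NonZero p}} (p-prime : Prime p) (p≡ : p ≡ 2 + 3 * w) where

  private
    fermat-cube : ∀ x → x ≡ (x ^ 3) ^ w * (x * x) mod p
    fermat-cube x = begin
      x % p                          ≡⟨ fermat p-prime x ⟨
      x ^ p % p                      ≡⟨ cong (λ e → x ^ e % p) (trans p≡ (+-comm 2 (3 * w))) ⟩
      x ^ (3 * w + 2) % p            ≡⟨ cong (_% p) (^-distribˡ-+-* x (3 * w) 2) ⟩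
      x ^ (3 * w) * x ^ 2 % p        ≡⟨ cong (λ y → y * x ^ 2 % p) (^-*-assoc x 3 w) ⟨
      (x ^ 3) ^ w * x ^ 2 % p        ≡⟨ cong (λ y → (x ^ 3) ^ w * y % p) (cong (x *_) (*-identityʳ x)) ⟩
      (x ^ 3) ^ w * (x * x) % p      ∎
      where open ≡-Reasoning

  -- 3q(q+1) + 1 = (q+1)³ − q³, and cubing is injective modulo p.
  prime∤3q[q+1]+1 : ∀ q → ¬ p ∣ 3 * (q * suc q) + 1
  prime∤3q[q+1]+1 q p∣D = <⇒≱ (subst (1 <_) (sym p≡) (s<s z<s)) (∣⇒≤ p∣1)
    where
    D = 3 * (q * suc q) + 1
    X = (q ^ 3) ^ w
    cubes≡ : suc q ^ 3 ≡ q ^ 3 mod p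
    cubes≡ = trans (cong (_% p) (difference-of-cubes q)) (%-remove-+ʳ (q ^ 3) p∣D)
      where
      difference-of-cubes : ∀ a → suc a * (suc a * (suc a * 1)) ≡ a * (a * (a * 1)) + (3 * (a * suc a) + 1)
      difference-of-cubes = solve-∀
    q+1≡ : suc q ≡ X * (suc q * suc q) mod p
    q+1≡ = trans (fermat-cube (suc q)) (*-cong-mod (^-cong-mod cubes≡ w) (refl {x = suc q * suc q % p}))
    q*q*[q+1]≡ : q * q * suc q + q * suc q ≡ q * q * suc q mod p
    q*q*[q+1]≡ = sym (begin
      q * q * suc q % p                          ≡⟨ *-cong-mod {a = q * q} refl q+1≡ ⟩
      q * q * (X * (suc q * suc q)) % p          ≡⟨ cong (_% p) (regroup q X) ⟩
      X * (q * q) * (suc q * suc q) % p          ≡⟨ *-cong-mod {c = suc q * suc q} (fermat-cube q) refl ⟨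
      q * (suc q * suc q) % p                    ≡⟨ cong (_% p) (expand q) ⟩
      (q * q * suc q + q * suc q) % p            ∎)
      where
      open ≡-Reasoning
      regroup : ∀ a x → a * a * (x * (suc a * suc a)) ≡ x * (a * a) * (suc a * suc a)
      regroup = solve-∀
      expand : ∀ a → a * (suc a * suc a) ≡ a * a * suc a + a * suc a
      expand = solve-∀
    p∣1 : p ∣ 1
    p∣1 = ∣m+n∣m⇒∣n p∣D (∣n⇒∣m*n 3 (≡-mod⇒∣ _ _ q*q*[q+1]≡))

-- Residue classes along windows and arithmetic progressions

module _ (m : ℕ) .{{_ : NonZero m}} where

  χ : ℕ → ℕ → ℕ
  χ t x = 𝟙 (does (x % m ≟ t))

  χ-cong-mod : ∀ {x y} t → x ≡ y mod m → χ t x ≡ χ t y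
  χ-cong-mod t x≡y = cong (λ r → 𝟙 (does (r ≟ t))) x≡y

  suc-cancel-mod : ∀ {a b} → suc a ≡ suc b mod m → a ≡ b mod m
  suc-cancel-mod {a} {b} sa≡sb = begin
    a % m                 ≡⟨ [m+n]%n≡m%n a m ⟨
    (a + m) % m           ≡⟨ cong (_% m) (a+m≡ a) ⟩
    (suc a + pred m) % m  ≡⟨ +-cong-mod {a = suc a} {b = suc b} {c = pred m} sa≡sb refl ⟩
    (suc b + pred m) % m  ≡⟨ cong (_% m) (a+m≡ b) ⟨
    (b + m) % m           ≡⟨ [m+n]%n≡m%n b m ⟩
    b % m                 ∎
    where
    open ≡-Reasoning
    a+m≡ : ∀ a → a + m ≡ suc a + pred m
    a+m≡ a = trans (cong (a +_) (sym (suc-pred m))) (+-suc a (pred m))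

  χ-suc : ∀ x t → t < m → χ t x ≡ χ (suc t % m) (suc x)
  χ-suc x t t<m with x % m ≟ t
  ... | yes x≡t = trans (cong 𝟙 (dec-true (x % m ≟ t) x≡t)) (sym (cong 𝟙 (dec-true (suc x % m ≟ suc t % m) sx≡st)))
    where sx≡st = +-cong-mod {a = 1} {b = 1} refl (trans x≡t (sym (m<n⇒m%n≡m t<m)))
  ... | no x≢t  = trans (cong 𝟙 (dec-false (x % m ≟ t) x≢t)) (sym (cong 𝟙 (dec-false (suc x % m ≟ suc t % m) sx≢st)))
    where sx≢st = λ sx≡st → x≢t (trans (suc-cancel-mod sx≡st) (m<n⇒m%n≡m t<m))

  ∑-χ : ∀ x → ∑[ t < m ] χ t x ≡ 1
  ∑-χ x = trans (∑-unique m (x % m) (λ t → χ t x) (m%n<n x m)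
                  (λ t _ t≢ → cong 𝟙 (dec-false (x % m ≟ t) (λ x≡t → t≢ (sym x≡t)))))
                (cong 𝟙 (dec-true (x % m ≟ x % m) refl))

  intervalCount : ℕ → ℕ → ℕ → ℕ
  intervalCount L len t = ∑[ k < len ] χ t (L + k)

  intervalCount-telescope : ∀ L len t → t < m → let t′ = suc t % m in
    intervalCount L len t + χ t′ L ≡ intervalCount L len t′ + χ t′ (L + len)
  intervalCount-telescope L len t t<m = begin
    intervalCount L len t + χ t′ L                       ≡⟨ cong (_+ χ t′ L) (∑-cong len (λ k _ → χ-suc (L + k) t t<m)) ⟩
    ∑[ k < len ] χ t′ (suc (L + k)) + χ t′ L             ≡⟨ +-comm _ (χ t′ L) ⟩
    χ t′ L + ∑[ k < len ] χ t′ (suc (L + k))             ≡⟨ cong₂ _+_ (cong (χ t′) (sym (+-identityʳ L)))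
                                                                        (∑-cong len (λ k _ → cong (χ t′) (sym (+-suc L k)))) ⟩
    intervalCount L (suc len) t′                         ≡⟨ ∑-last len (λ k → χ t′ (L + k)) ⟩
    intervalCount L len t′ + χ t′ (L + len)              ∎
    where
    open ≡-Reasoning
    t′ = suc t % m

  -- Telescoping in t: count t + #{left ends in class t + 1} ≡ count (t + 1) + #{right ends in class t + 1}.
  intervals-equidistributed : ∀ K (L len : ℕ → ℕ) →
    (∀ t → ∑[ u < K ] χ t (L u) ≡ ∑[ u < K ] χ t (L u + len u)) →
    ∀ i → i < m → m * ∑[ u < K ] intervalCount (L u) (len u) i ≡ ∑< K len
  intervals-equidistributed K L len balanced i i<m = begin
    m * count i              ≡⟨ cong (m *_) (all-equal i i<m) ⟩
    m * count 0              ≡⟨ ∑-const m (count 0) ⟨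
    ∑[ t < m ] count 0       ≡⟨ ∑-cong m all-equal ⟨
    ∑[ t < m ] count t       ≡⟨ ∑-comm m K (λ t u → intervalCount (L u) (len u) t) ⟩
    ∑[ u < K ] ∑[ t < m ] intervalCount (L u) (len u) t
                             ≡⟨ ∑-cong K (λ u _ → ∑-comm m (len u) (λ t k → χ t (L u + k))) ⟩
    ∑[ u < K ] ∑[ k < len u ] ∑[ t < m ] χ t (L u + k)
                             ≡⟨ ∑-cong K (λ u _ → trans (∑-cong (len u) (λ k _ → ∑-χ (L u + k))) (trans (∑-const (len u) 1) (*-identityʳ (len u)))) ⟩
    ∑< K len                 ∎
    where
    open ≡-Reasoning
    count : ℕ → ℕ
    count t = ∑[ u < K ] intervalCount (L u) (len u) t
    step : ∀ t → t < m → count t ≡ count (suc t % m)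
    step t t<m = +-cancelʳ-≡ (∑[ u < K ] χ t′ (L u)) _ _ (begin
      count t + ∑[ u < K ] χ t′ (L u)                       ≡⟨ ∑-distrib-+ K (λ u → intervalCount (L u) (len u) t) (λ u → χ t′ (L u)) ⟨
      ∑[ u < K ] (intervalCount (L u) (len u) t + χ t′ (L u))
                                                           ≡⟨ ∑-cong K (λ u _ → intervalCount-telescope (L u) (len u) t t<m) ⟩
      ∑[ u < K ] (intervalCount (L u) (len u) t′ + χ t′ (L u + len u))
                                                           ≡⟨ ∑-distrib-+ K (λ u → intervalCount (L u) (len u) t′) (λ u → χ t′ (L u + len u)) ⟩
      count t′ + ∑[ u < K ] χ t′ (L u + len u)              ≡⟨ cong (count t′ +_) (balanced t′) ⟨
      count t′ + ∑[ u < K ] χ t′ (L u)                      ∎)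
      where t′ = suc t % m
    all-equal : ∀ t → t < m → count t ≡ count 0
    all-equal zero    _     = refl
    all-equal (suc t) t+1<m = trans (sym (trans (step t t<m) (cong count (m<n⇒m%n≡m t+1<m)))) (all-equal t t<m)
      where t<m = <-trans (n<1+n t) t+1<m

  progressionCount : ℕ → ℕ → ℕ → ℕ → ℕ
  progressionCount d s L t = ∑[ k < L ] χ t (s + d * k)

  module _ (d : ℕ) where

    private
      P = progressionCount d

    progression-split : ∀ s A B t → P s (A + B) t ≡ P s A t + P (s + d * A) B t
    progression-split s A B t = trans (∑-split A B _) (cong (P s A t +_) (∑-cong B (λ k _ → cong (χ t) (reassoc s A k))))
      where
      reassoc : ∀ s A k → s + d * (A + k) ≡ s + d * A + d * k
      reassoc s A k = trans (cong (s +_) (*-distribˡ-+ d A k)) (sym (+-assoc s _ _))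

    progression-shift : ∀ s c L t → P (s + c * m) L t ≡ P s L t
    progression-shift s c L t = ∑-cong L (λ k _ → χ-cong-mod t
      (trans (cong (_% m) (swap s (c * m) (d * k))) ([m+kn]%n≡m%n (s + d * k) c m)))
      where
      swap : ∀ a b c → a + b + c ≡ a + c + b
      swap = solve-∀

    progression-step : ∀ s t → P (s + d) m t ≡ P s m t
    progression-step s t = +-cancelˡ-≡ (χ t s) _ _ (begin
      χ t s + P (s + d) m t             ≡⟨ cong₂ _+_ (cong (χ t) (sym s+d*0≡s)) (∑-cong m (λ k _ → cong (χ t) (reassoc k))) ⟩
      P s (suc m) t                     ≡⟨ ∑-last m _ ⟩
      P s m t + χ t (s + d * m)         ≡⟨ cong (P s m t +_) (χ-cong-mod t ([m+kn]%n≡m%n s d m)) ⟩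
      P s m t + χ t s                   ≡⟨ +-comm (P s m t) (χ t s) ⟩
      χ t s + P s m t                   ∎)
      where
      open ≡-Reasoning
      s+d*0≡s : s + d * 0 ≡ s
      s+d*0≡s = trans (cong (s +_) (*-zeroʳ d)) (+-identityʳ s)
      reassoc : ∀ k → s + d + d * k ≡ s + d * suc k
      reassoc k = trans (+-assoc s d _) (cong (s +_) (sym (*-suc d k)))

    progression-steps : ∀ s k t → P (s + d * k) m t ≡ P s m t
    progression-steps s zero    t = cong (λ x → P x m t) (trans (cong (s +_) (*-zeroʳ d)) (+-identityʳ s))
    progression-steps s (suc k) t = begin
      P (s + d * suc k) m t       ≡⟨ cong (λ x → P x m t) (trans (cong (s +_) (*-suc d k)) (+-comm-middle s d (d * k))) ⟩
      P (s + d * k + d) m t       ≡⟨ progression-step (s + d * k) t ⟩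
      P (s + d * k) m t           ≡⟨ progression-steps s k t ⟩
      P s m t                     ∎
      where
      open ≡-Reasoning
      +-comm-middle : ∀ a b c → a + (b + c) ≡ a + c + b
      +-comm-middle = solve-∀

    -- w inverts d modulo m, so any start s′ is reached from s by whole steps d and multiples of m.
    module _ {w c : ℕ} (d*w≡ : d * w ≡ 1 + c * m) where

      progression-start-free : ∀ s s′ t → P s m t ≡ P s′ m t
      progression-start-free s s′ t = begin
        P s m t                                 ≡⟨ progression-steps s (w * y) t ⟨
        P (s + d * (w * y)) m t                 ≡⟨ cong (λ x → P x m t) reach ⟩
        P (s′ + (s + c * y) * m) m t            ≡⟨ progression-shift s′ (s + c * y) m t ⟩
        P s′ m t                                ∎
        where
        open ≡-Reasoning
        y = s′ + pred m * s
        reach : s + d * (w * y) ≡ s′ + (s + c * y) * m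
        reach = begin
          s + d * (w * y)                       ≡⟨ cong (s +_) (sym (*-assoc d w y)) ⟩
          s + d * w * y                         ≡⟨ cong (λ z → s + z * y) d*w≡ ⟩
          s + (1 + c * m) * y                   ≡⟨ cong (λ M → s + (1 + c * M) * (s′ + pred m * s)) (sym (suc-pred m)) ⟩
          s + (1 + c * suc (pred m)) * y        ≡⟨ identity s s′ c (pred m) ⟩
          s′ + (s + c * y) * suc (pred m)       ≡⟨ cong (λ M → s′ + (s + c * y) * M) (suc-pred m) ⟩
          s′ + (s + c * y) * m                  ∎
          where
          identity : ∀ s s′ c n → s + (1 + c * suc n) * (s′ + n * s) ≡ s′ + (s + c * (s′ + n * s)) * suc n
          identity = solve-∀

      progression-start-free-periods : ∀ L s s′ t → m ∣ L → P s L t ≡ P s′ L t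
      progression-start-free-periods L s s′ t (divides q refl) = go q
        where
        go : ∀ q → P s (q * m) t ≡ P s′ (q * m) t
        go zero    = refl
        go (suc q) = begin
          P s (m + q * m) t                       ≡⟨ progression-split s m (q * m) t ⟩
          P s m t + P (s + d * m) (q * m) t       ≡⟨ cong₂ _+_ (progression-start-free s s′ t) (progression-shift s d (q * m) t) ⟩
          P s′ m t + P s (q * m) t                ≡⟨ cong (P s′ m t +_) (go q) ⟩
          P s′ m t + P s′ (q * m) t               ≡⟨ cong (P s′ m t +_) (progression-shift s′ d (q * m) t) ⟨
          P s′ m t + P (s′ + d * m) (q * m) t     ≡⟨ progression-split s′ m (q * m) t ⟨
          P s′ (m + q * m) t                      ∎
          where open ≡-Reasoning

-- Partitions into three parts, sorted by their smallest part

half-≤ : ∀ {r x} → r ≤ x + x → ⌈ r /2⌉ ≤ x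
half-≤ {x = x} r≤2x = subst (_ ≤_) (sym (n≡⌈n+n/2⌉ x)) (⌈n/2⌉-mono r≤2x)

≤-half : ∀ r {x} → ⌈ r /2⌉ ≤ x → r ≤ x + x
≤-half r ⌈r/2⌉≤x = subst (_≤ _) (⌊n/2⌋+⌈n/2⌉≡n r) (+-mono-≤ (≤-trans (⌊n/2⌋≤⌈n/2⌉ r) ⌈r/2⌉≤x) ⌈r/2⌉≤x)

partition-bounds : ∀ {r a b c} → IsPartition3 (r + 3 * c) (a , b , c) → c + ⌈ r /2⌉ ≤ a × a ≤ c + r
partition-bounds {r} {a} {b} {c} (sum≡ , b≤a , c≤b , _) with m≤n⇒∃[o]m+o≡n (≤-trans c≤b b≤a)
... | d , refl = +-monoʳ-≤ c (half-≤ (+-cancelˡ-≤ (3 * c) _ _ r≤2d)) , +-cancelʳ-≤ (c + c) _ _ a+2c≤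
  where
  open ≤-Reasoning
  r≤2d : 3 * c + r ≤ 3 * c + (d + d)
  r≤2d = begin
    3 * c + r                 ≡⟨ +-comm (3 * c) r ⟩
    r + 3 * c                 ≡⟨ sum≡ ⟨
    c + d + b + c             ≤⟨ +-monoˡ-≤ c (+-monoʳ-≤ (c + d) b≤a) ⟩
    c + d + (c + d) + c       ≡⟨ shuffle c d ⟩
    3 * c + (d + d)           ∎
    where
    shuffle : ∀ c d → c + d + (c + d) + c ≡ 3 * c + (d + d)
    shuffle = solve-∀
  a+2c≤ : c + d + (c + c) ≤ c + r + (c + c)
  a+2c≤ = begin
    c + d + (c + c)           ≡⟨ +-assoc (c + d) c c ⟨
    c + d + c + c             ≤⟨ +-monoˡ-≤ c (+-monoʳ-≤ (c + d) c≤b) ⟩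
    c + d + b + c             ≡⟨ sum≡ ⟩
    r + 3 * c                 ≡⟨ shuffle r c ⟩
    c + r + (c + c)           ∎
    where
    shuffle : ∀ r c → r + 3 * c ≡ c + r + (c + c)
    shuffle = solve-∀

partition-fill : ∀ {r a c} → 0 < c → c + ⌈ r /2⌉ ≤ a → a ≤ c + r →
  IsPartition3 (r + 3 * c) (a , r + 3 * c ∸ (a + c) , c)
partition-fill {r} {a} {c} 0<c lo≤a a≤hi
  with m≤n⇒∃[o]m+o≡n (≤-trans (m≤m+n c _) lo≤a)
... | d , refl with m≤n⇒∃[o]m+o≡n (+-cancelˡ-≤ c _ _ a≤hi)
... | s , refl = sum≡ , b≤a , c≤b , 0<c
  where
  n≡ : d + s + 3 * c ≡ c + d + c + (s + c)
  n≡ = shuffle c d s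
    where
    shuffle : ∀ c d s → d + s + 3 * c ≡ c + d + c + (s + c)
    shuffle = solve-∀
  b≡ : d + s + 3 * c ∸ (c + d + c) ≡ s + c
  b≡ = trans (cong (_∸ (c + d + c)) n≡) (m+n∸m≡n (c + d + c) (s + c))
  sum≡ : c + d + (d + s + 3 * c ∸ (c + d + c)) + c ≡ d + s + 3 * c
  sum≡ = trans (cong (λ b → c + d + b + c) b≡) (trans (shuffle c d s) (sym n≡))
    where
    shuffle : ∀ c d s → c + d + (s + c) + c ≡ c + d + c + (s + c)
    shuffle = solve-∀
  s≤d : s ≤ d
  s≤d = +-cancelˡ-≤ d _ _ (≤-half (d + s) (+-cancelˡ-≤ c _ _ lo≤a))
  b≤a : d + s + 3 * c ∸ (c + d + c) ≤ c + d
  b≤a = subst (_≤ c + d) (sym b≡) (subst (s + c ≤_) (+-comm d c) (+-monoˡ-≤ c s≤d))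
  c≤b : c ≤ d + s + 3 * c ∸ (c + d + c)
  c≤b = subst (c ≤_) (sym b≡) (m≤n+m c s)

partition-smallest≤ : ∀ {n a b c} → IsPartition3 n (a , b , c) → 3 * c ≤ n
partition-smallest≤ {n} {a} {b} {c} (sum≡ , b≤a , c≤b , _) = begin
  3 * c          ≡⟨ shuffle c ⟩
  c + c + c      ≤⟨ +-monoˡ-≤ c (+-mono-≤ (≤-trans c≤b b≤a) c≤b) ⟩
  a + b + c      ≡⟨ sum≡ ⟩
  n              ∎
  where
  open ≤-Reasoning
  shuffle : ∀ c → 3 * c ≡ c + c + c
  shuffle = solve-∀

spread : Triple → ℕ
spread (a , _ , c) = a ∸ c

spreadSum : (ℕ → ℕ) → ℕ → ℕ
spreadSum g n = ∑[ t ∈ P3 n ] g (spread t)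

sliceSum : (ℕ → ℕ) → ℕ → ℕ
sliceSum g r = ∑[ k < suc ⌊ r /2⌋ ] g (⌈ r /2⌉ + k)

halves-sum : ∀ r → ⌈ r /2⌉ + suc ⌊ r /2⌋ ≡ suc r
halves-sum r = trans (+-suc ⌈ r /2⌉ ⌊ r /2⌋) (cong suc (trans (+-comm ⌈ r /2⌉ ⌊ r /2⌋) (⌊n/2⌋+⌈n/2⌉≡n r)))

module _ (g : ℕ → ℕ) where

  private
    φ : ℕ → ℕ → ℕ → ℕ → ℕ
    φ n a b c = 𝟙 (does (isPartition3? n (a , b , c))) * g (a ∸ c)

    φ-vanish : ∀ n a b c → ¬ IsPartition3 n (a , b , c) → φ n a b c ≡ 0
    φ-vanish n a b c ¬p = cong (λ x → 𝟙 x * g (a ∸ c)) (dec-false (isPartition3? n _) ¬p)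

    φ-partition : ∀ n a b c → IsPartition3 n (a , b , c) → φ n a b c ≡ g (a ∸ c)
    φ-partition n a b c p =
      trans (cong (λ x → 𝟙 x * g (a ∸ c)) (dec-true (isPartition3? n _) p)) (+-identityʳ _)

    spreadSum≡∑∑∑ : ∀ n → spreadSum g n ≡ ∑[ a < suc n ] ∑[ b < suc n ] ∑[ c < suc n ] φ n a b c
    spreadSum≡∑∑∑ n = begin
      spreadSum g n                                          ≡⟨ ∑ˡ-filter (isPartition3? n) (triplesUpTo n) (λ t → g (spread t)) ⟩
      ∑[ t ∈ triplesUpTo n ] F t                             ≡⟨ ∑ˡ-concatMap (λ a → concatMap (column a) (upTo N)) (upTo N) F ⟩
      ∑[ a ∈ upTo N ] ∑ˡ (concatMap (column a) (upTo N)) F   ≡⟨ ∑ˡ-upTo N (λ a → ∑ˡ (concatMap (column a) (upTo N)) F) ⟩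
      ∑[ a < N ] ∑ˡ (concatMap (column a) (upTo N)) F        ≡⟨ ∑-cong N (λ a _ → ∑ˡ-concatMap (column a) (upTo N) F) ⟩
      ∑[ a < N ] ∑[ b ∈ upTo N ] ∑ˡ (column a b) F           ≡⟨ ∑-cong N (λ a _ → ∑ˡ-upTo N (λ b → ∑ˡ (column a b) F)) ⟩
      ∑[ a < N ] ∑[ b < N ] ∑ˡ (column a b) F                ≡⟨ ∑-cong N (λ a _ → ∑-cong N (λ b _ → ∑ˡ-map (λ c → (a , b , c)) (upTo N) F)) ⟩
      ∑[ a < N ] ∑[ b < N ] ∑[ c ∈ upTo N ] φ n a b c        ≡⟨ ∑-cong N (λ a _ → ∑-cong N (λ b _ → ∑ˡ-upTo N (φ n a b))) ⟩
      ∑[ a < N ] ∑[ b < N ] ∑[ c < N ] φ n a b c             ∎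
      where
      open ≡-Reasoning
      N = suc n
      F : Triple → ℕ
      F t = 𝟙 (does (isPartition3? n t)) * g (spread t)
      column : ℕ → ℕ → List Triple
      column a b = map (λ c → (a , b , c)) (upTo N)

    middle-part-forced : ∀ n a c → ∑[ b < suc n ] φ n a b c ≡ φ n a (n ∸ (a + c)) c
    middle-part-forced n a c = ∑-unique (suc n) (n ∸ (a + c)) (λ b → φ n a b c) (s≤s (m∸n≤m n (a + c)))
      (λ b _ b≢ → φ-vanish n a b c (λ p → b≢ (forced (proj₁ p))))
      where
      forced : ∀ {b} → a + b + c ≡ n → b ≡ n ∸ (a + c)
      forced {b} sum≡ = trans (sym (m+n∸m≡n (a + c) b)) (cong (_∸ (a + c)) (trans (swap a c b) sum≡))
        where
        swap : ∀ a c b → a + c + b ≡ a + b + c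
        swap = solve-∀

    slice : ∀ r c → 0 < c → ∑[ a < suc (r + 3 * c) ] φ (r + 3 * c) a (r + 3 * c ∸ (a + c)) c ≡ sliceSum g r
    slice r c 0<c = trans
      (∑-support (suc n) lo (suc ⌊ r /2⌋) (λ a → φ n a (n ∸ (a + c)) c) hi≤N
        (λ x x<lo → φ-vanish n x (n ∸ (x + c)) c (λ p → <⇒≱ x<lo (proj₁ (partition-bounds p))))
        (λ x hi≤x _ → φ-vanish n x (n ∸ (x + c)) c (λ p → <⇒≱ (subst (_≤ x) lo+len≡ hi≤x) (proj₂ (partition-bounds p)))))
      (∑-cong (suc ⌊ r /2⌋) inside)
      where
      n = r + 3 * c
      lo = c + ⌈ r /2⌉
      lo+len≡ : lo + suc ⌊ r /2⌋ ≡ suc (c + r)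
      lo+len≡ = trans (+-assoc c _ _) (trans (cong (c +_) (halves-sum r)) (+-suc c r))
      hi≤N : lo + suc ⌊ r /2⌋ ≤ suc (r + 3 * c)
      hi≤N = subst (_≤ suc n) (sym lo+len≡) (s≤s (subst (_≤ r + 3 * c) (+-comm r c) (+-monoʳ-≤ r (m≤n*m c 3))))
      inside : ∀ k → k < suc ⌊ r /2⌋ → φ (r + 3 * c) (lo + k) (r + 3 * c ∸ (lo + k + c)) c ≡ g (⌈ r /2⌉ + k)
      inside k k<len = trans
        (φ-partition n (lo + k) (n ∸ (lo + k + c)) c (partition-fill 0<c (m≤m+n lo k) (s≤s⁻¹ (subst (lo + k <_) lo+len≡ (+-monoʳ-< lo k<len)))))
        (cong g (trans (cong (_∸ c) (+-assoc c _ k)) (m+n∸m≡n c _)))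

  spreadSum-slices : ∀ {n ρ K} → n ≡ ρ + 3 * K → ρ < 3 → spreadSum g n ≡ ∑[ u < K ] sliceSum g (ρ + 3 * u)
  spreadSum-slices {n} {ρ} {K} refl ρ<3 = begin
    spreadSum g n                                              ≡⟨ spreadSum≡∑∑∑ n ⟩
    ∑[ a < N ] ∑[ b < N ] ∑[ c < N ] φ n a b c                 ≡⟨ ∑-cong N (λ a _ → ∑-comm N N (φ n a)) ⟩
    ∑[ a < N ] ∑[ c < N ] ∑[ b < N ] φ n a b c                 ≡⟨ ∑-cong N (λ a _ → ∑-cong N (λ c _ → middle-part-forced n a c)) ⟩
    ∑[ a < N ] ∑[ c < N ] φ n a (n ∸ (a + c)) c                ≡⟨ ∑-comm N N (λ a c → φ n a (n ∸ (a + c)) c) ⟩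
    ∑< N column                                                ≡⟨ ∑-support N 1 K column (s≤s (≤-trans (m≤n*m K 3) (m≤n+m (3 * K) ρ))) none-empty too-large ⟩
    ∑[ k < K ] column (suc k)                                  ≡⟨ ∑-reverse K (λ k → column (suc k)) ⟩
    ∑[ u < K ] column (suc (K ∸ suc u))                        ≡⟨ ∑-cong K as-slice ⟩
    ∑[ u < K ] sliceSum g (ρ + 3 * u)                          ∎
    where
    open ≡-Reasoning
    N = suc n
    column : ℕ → ℕ
    column c = ∑[ a < N ] φ n a (n ∸ (a + c)) c
    none-empty : ∀ c → c < 1 → column c ≡ 0
    none-empty 0 z<s = ∑-vanish N (λ a _ → φ-vanish n a (n ∸ (a + 0)) 0 (λ p → <-irrefl refl (proj₂ (proj₂ (proj₂ p)))))
    too-large : ∀ c → 1 + K ≤ c → c < N → column c ≡ 0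
    too-large c K<c _ = ∑-vanish N (λ a _ → φ-vanish n a (n ∸ (a + c)) c (λ p → <⇒≱ n<3c (partition-smallest≤ p)))
      where
      n<3c : n < 3 * c
      n<3c = ≤-trans (subst (n <_) (sym (*-distribˡ-+ 3 1 K)) (+-monoˡ-< (3 * K) ρ<3)) (*-monoʳ-≤ 3 K<c)
    as-slice : ∀ u → u < K → column (suc (K ∸ suc u)) ≡ sliceSum g (ρ + 3 * u)
    as-slice u u<K = subst (λ n → ∑[ a < suc n ] φ n a (n ∸ (a + c)) c ≡ sliceSum g (ρ + 3 * u)) n≡ (slice (ρ + 3 * u) c z<s)
      where
      c = suc (K ∸ suc u)
      n≡ : ρ + 3 * u + 3 * c ≡ ρ + 3 * K
      n≡ = trans (+-assoc ρ _ _) (cong (ρ +_) (trans (sym (*-distribˡ-+ 3 u c)) (cong (3 *_) (trans (+-suc u _) (m+[n∸m]≡n u<K)))))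

-- Equidistribution of λ₁ − λ₃ modulo m

⌊x+2y/2⌋ : ∀ x y → ⌊ (x + 2 * y) /2⌋ ≡ ⌊ x /2⌋ + y
⌊x+2y/2⌋ x zero    = trans (cong ⌊_/2⌋ (trans (cong (x +_) (*-zeroʳ 2)) (+-identityʳ x))) (sym (+-identityʳ _))
⌊x+2y/2⌋ x (suc y) = trans (cong ⌊_/2⌋ (two-more x y)) (trans (cong suc (⌊x+2y/2⌋ x y)) (sym (+-suc _ y)))
  where
  two-more : ∀ x y → x + 2 * suc y ≡ suc (suc (x + 2 * y))
  two-more = solve-∀

∑-arithmetic : ∀ a h → 2 * ∑[ l < h ] (a + 3 * l) + 3 * h ≡ 2 * a * h + 3 * (h * h)
∑-arithmetic a zero    = sym (cong (_+ 0) (*-zeroʳ (2 * a)))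
∑-arithmetic a (suc h) = begin
  2 * ∑[ l < suc h ] (a + 3 * l) + 3 * suc h            ≡⟨ cong (λ s → 2 * s + 3 * suc h) (∑-last h (λ l → a + 3 * l)) ⟩
  2 * (S + (a + 3 * h)) + 3 * suc h                     ≡⟨ regroup S a h ⟩
  (2 * S + 3 * h) + (2 * a + 6 * h + 3)                 ≡⟨ cong (_+ (2 * a + 6 * h + 3)) (∑-arithmetic a h) ⟩
  2 * a * h + 3 * (h * h) + (2 * a + 6 * h + 3)         ≡⟨ collect a h ⟩
  2 * a * suc h + 3 * (suc h * suc h)                   ∎
  where
  open ≡-Reasoning
  S = ∑[ l < h ] (a + 3 * l)
  regroup : ∀ s a h → 2 * (s + (a + 3 * h)) + 3 * suc h ≡ (2 * s + 3 * h) + (2 * a + 6 * h + 3)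
  regroup = solve-∀
  collect : ∀ a h → 2 * a * h + 3 * (h * h) + (2 * a + 6 * h + 3) ≡ 2 * a * suc h + 3 * (suc h * suc h)
  collect = solve-∀

p3-slices : ∀ {n ρ K} → n ≡ ρ + 3 * K → ρ < 3 → p3 n ≡ ∑[ u < K ] suc ⌊ (ρ + 3 * u) /2⌋
p3-slices {n} {ρ} {K} n≡ ρ<3 = begin
  p3 n                                                ≡⟨ length≡∑ˡ1 (P3 n) ⟩
  spreadSum (λ _ → 1) n                               ≡⟨ spreadSum-slices (λ _ → 1) {K = K} n≡ ρ<3 ⟩
  ∑[ u < K ] sliceSum (λ _ → 1) (ρ + 3 * u)           ≡⟨ ∑-cong K (λ u _ → trans (∑-const (suc ⌊ (ρ + 3 * u) /2⌋) 1) (*-identityʳ _)) ⟩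
  ∑[ u < K ] suc ⌊ (ρ + 3 * u) /2⌋                    ∎
  where open ≡-Reasoning

⌈ρ+3[2l]/2⌉ : ∀ ρ l → ⌈ (ρ + 3 * (2 * l)) /2⌉ ≡ ⌈ ρ /2⌉ + 3 * l
⌈ρ+3[2l]/2⌉ ρ l = trans (cong ⌊_/2⌋ (regroup ρ l)) (⌊x+2y/2⌋ (suc ρ) (3 * l))
  where
  regroup : ∀ ρ l → suc (ρ + 3 * (2 * l)) ≡ suc ρ + 2 * (3 * l)
  regroup = solve-∀

⌈ρ+3[1+2l]/2⌉ : ∀ ρ l → ⌈ (ρ + 3 * (1 + 2 * l)) /2⌉ ≡ ⌈ (ρ + 3) /2⌉ + 3 * l
⌈ρ+3[1+2l]/2⌉ ρ l = trans (cong ⌊_/2⌋ (regroup ρ l)) (⌊x+2y/2⌋ (suc (ρ + 3)) (3 * l))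
  where
  regroup : ∀ ρ l → suc (ρ + 3 * (1 + 2 * l)) ≡ suc (ρ + 3) + 2 * (3 * l)
  regroup = solve-∀

⌊ρ+3[2l]/2⌋ : ∀ ρ l → ⌊ (ρ + 3 * (2 * l)) /2⌋ ≡ ⌊ ρ /2⌋ + 3 * l
⌊ρ+3[2l]/2⌋ ρ l = trans (cong ⌊_/2⌋ (regroup ρ l)) (⌊x+2y/2⌋ ρ (3 * l))
  where
  regroup : ∀ ρ l → ρ + 3 * (2 * l) ≡ ρ + 2 * (3 * l)
  regroup = solve-∀

⌊ρ+3[1+2l]/2⌋ : ∀ ρ l → ⌊ (ρ + 3 * (1 + 2 * l)) /2⌋ ≡ ⌊ (ρ + 3) /2⌋ + 3 * l
⌊ρ+3[1+2l]/2⌋ ρ l = trans (cong ⌊_/2⌋ (regroup ρ l)) (⌊x+2y/2⌋ (ρ + 3) (3 * l))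
  where
  regroup : ∀ ρ l → ρ + 3 * (1 + 2 * l) ≡ ρ + 3 + 2 * (3 * l)
  regroup = solve-∀

p3-by-parity : ∀ {n} ρ e q → n ≡ ρ + 3 * (e + 2 * q) → ρ < 3 → e < 2 →
  p3 n ≡ ∑[ l < e + q ] (suc ⌊ ρ /2⌋ + 3 * l) + ∑[ l < q ] (suc ⌊ (ρ + 3) /2⌋ + 3 * l)
p3-by-parity {n} ρ e q n≡ ρ<3 e<2 = begin
  p3 n                                               ≡⟨ p3-slices {K = e + 2 * q} n≡ ρ<3 ⟩
  ∑[ u < e + 2 * q ] suc ⌊ (ρ + 3 * u) /2⌋           ≡⟨ ∑-parity e q _ e<2 ⟩
  ∑[ l < e + q ] suc ⌊ (ρ + 3 * (2 * l)) /2⌋ + ∑[ l < q ] suc ⌊ (ρ + 3 * (1 + 2 * l)) /2⌋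
                                                     ≡⟨ cong₂ _+_ (∑-cong (e + q) (λ l _ → cong suc (⌊ρ+3[2l]/2⌋ ρ l)))
                                                                  (∑-cong q (λ l _ → cong suc (⌊ρ+3[1+2l]/2⌋ ρ l))) ⟩
  ∑[ l < e + q ] (suc ⌊ ρ /2⌋ + 3 * l) + ∑[ l < q ] (suc ⌊ (ρ + 3) /2⌋ + 3 * l)  ∎
  where open ≡-Reasoning

∑-arithmetic-pair : ∀ a b h q F → 2 * F + 3 * h + 3 * q ≡ 2 * a * h + 3 * (h * h) + (2 * b * q + 3 * (q * q)) →
  ∑[ l < h ] (a + 3 * l) + ∑[ l < q ] (b + 3 * l) ≡ F
∑-arithmetic-pair a b h q F doubled = *-cancelˡ-≡ _ _ 2 (+-cancelʳ-≡ (3 * h + 3 * q) _ _ (begin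
  2 * (A + B) + (3 * h + 3 * q)            ≡⟨ regroup A B h q ⟩
  (2 * A + 3 * h) + (2 * B + 3 * q)        ≡⟨ cong₂ _+_ (∑-arithmetic a h) (∑-arithmetic b q) ⟩
  2 * a * h + 3 * (h * h) + (2 * b * q + 3 * (q * q))
                                           ≡⟨ doubled ⟨
  2 * F + 3 * h + 3 * q                    ≡⟨ +-assoc (2 * F) _ _ ⟩
  2 * F + (3 * h + 3 * q)                  ∎))
  where
  open ≡-Reasoning
  A = ∑[ l < h ] (a + 3 * l)
  B = ∑[ l < q ] (b + 3 * l)
  regroup : ∀ x y h q → 2 * (x + y) + (3 * h + 3 * q) ≡ (2 * x + 3 * h) + (2 * y + 3 * q)
  regroup = solve-∀

module _ (m : ℕ) .{{_ : NonZero m}} where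

  private
    P = progressionCount m 3

  -- The windows of λ₁ − λ₃ for n = ρ + 3K are [⌈r/2⌉, r], r = ρ + 3u, u < K; Balanced says that their
  -- left ends ⌈r/2⌉ and their ends r + 1 = suc ρ + 3u past the right are equidistributed modulo m.
  Balanced : ℕ → ℕ → Set
  Balanced ρ K = ∀ t → ∑[ u < K ] χ m t ⌈ (ρ + 3 * u) /2⌉ ≡ P (suc ρ) K t

  countClass-uniform : ∀ {n ρ K} → n ≡ ρ + 3 * K → ρ < 3 → Balanced ρ K → ∀ i → i < m → countClass m n i ≡ p3 n / m
  countClass-uniform {n} {ρ} {K} n≡ ρ<3 balanced i i<m = begin
    countClass m n i                 ≡⟨ length-filter _ (P3 n) ⟩
    spreadSum (χ m i) n              ≡⟨ spreadSum-slices (χ m i) {K = K} n≡ ρ<3 ⟩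
    count                            ≡⟨ m*n/n≡m count m ⟨
    count * m / m                    ≡⟨ cong (_/ m) (trans (*-comm count m) m*count≡) ⟩
    ∑< K len / m                     ≡⟨ cong (_/ m) (p3-slices {K = K} n≡ ρ<3) ⟨
    p3 n / m                         ∎
    where
    open ≡-Reasoning
    L len : ℕ → ℕ
    L u = ⌈ (ρ + 3 * u) /2⌉
    len u = suc ⌊ (ρ + 3 * u) /2⌋
    count = ∑[ u < K ] intervalCount m (L u) (len u) i
    m*count≡ : m * count ≡ ∑< K len
    m*count≡ = intervals-equidistributed m K L len
      (λ t → trans (balanced t) (∑-cong K (λ u _ → cong (χ m t) (sym (halves-sum (ρ + 3 * u)))))) i i<m

  balanced-by-parity : ∀ ρ e q → e < 2 →
    (∀ t → P ⌈ ρ /2⌉ (e + q) t ≡ P (suc ρ + 3 * q) (e + q) t) →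
    (∀ t → P ⌈ (ρ + 3) /2⌉ q t ≡ P (suc ρ) q t) →
    Balanced ρ (e + 2 * q)
  balanced-by-parity ρ e q e<2 evens odds t = begin
    ∑[ u < e + 2 * q ] χ m t ⌈ (ρ + 3 * u) /2⌉         ≡⟨ ∑-parity e q (λ u → χ m t ⌈ (ρ + 3 * u) /2⌉) e<2 ⟩
    ∑[ l < e + q ] χ m t ⌈ (ρ + 3 * (2 * l)) /2⌉ + ∑[ l < q ] χ m t ⌈ (ρ + 3 * (1 + 2 * l)) /2⌉
                                                       ≡⟨ cong₂ _+_ (∑-cong (e + q) (λ l _ → cong (χ m t) (⌈ρ+3[2l]/2⌉ ρ l)))
                                                                    (∑-cong q (λ l _ → cong (χ m t) (⌈ρ+3[1+2l]/2⌉ ρ l))) ⟩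
    P ⌈ ρ /2⌉ (e + q) t + P ⌈ (ρ + 3) /2⌉ q t           ≡⟨ cong₂ _+_ (evens t) (odds t) ⟩
    P (suc ρ + 3 * q) (e + q) t + P (suc ρ) q t         ≡⟨ +-comm _ (P (suc ρ) q t) ⟩
    P (suc ρ) q t + P (suc ρ + 3 * q) (e + q) t         ≡⟨ progression-split m 3 (suc ρ) q (e + q) t ⟨
    P (suc ρ) (q + (e + q)) t                           ≡⟨ cong (λ K → P (suc ρ) K t) (regroup e q) ⟩
    P (suc ρ) (e + 2 * q) t                             ∎
    where
    open ≡-Reasoning
    regroup : ∀ e q → q + (e + q) ≡ e + 2 * q
    regroup = solve-∀

small-halves : ∀ {ρ} → 0 < ρ → ρ < 3 →
  (suc ⌊ ρ /2⌋ ≡ ρ) × (suc ⌊ (ρ + 3) /2⌋ ≡ 3) × (⌈ ρ /2⌉ ≡ 1) × (⌈ (ρ + 3) /2⌉ ≡ suc ρ)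
small-halves {1} _ _ = refl , refl , refl , refl
small-halves {2} _ _ = refl , refl , refl , refl
small-halves {suc (suc (suc _))} _ (s<s (s<s (s<s ())))

module _ {m w : ℕ} .{{_ : NonZero m}} (m-prime : Prime m) (m≡ : m ≡ 2 + 3 * w) where

  -- 3 (w + 1) = 1 + m: so w + 1 inverts 3 modulo m, and m ∤ 3.
  private
    P = progressionCount m 3

    start-free : ∀ L s s′ t → m ∣ L → P s L t ≡ P s′ L t
    start-free = progression-start-free-periods m 3 {w = suc w} {c = 1} (trans (*-suc 3 w) (cong suc (sym (trans (+-identityʳ m) m≡))))

    m∤3 : ¬ m ∣ 3
    m∤3 m∣3 = <⇒≱ (subst (1 <_) (sym m≡) (s<s z<s)) (∣⇒≤ (∣m+n∣m⇒∣n m∣m+1 (divides 1 (sym (+-identityʳ m)))))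
      where
      m∣m+1 : m ∣ m + 1
      m∣m+1 = subst (m ∣_) (trans (*-suc 3 w) (trans (cong suc (sym m≡)) (+-comm 1 m))) (∣m⇒∣m*n (suc w) m∣3)

  balanced-ρ≡0-even : ∀ {n} q → n ≡ 0 + 3 * (0 + 2 * q) → m ∣ p3 n → Balanced m 0 (0 + 2 * q)
  balanced-ρ≡0-even {n} q n≡ m∣p3 = balanced-by-parity m 0 0 q z<s
    (λ t → start-free q 0 (1 + 3 * q) t m∣q) (λ t → start-free q 2 1 t m∣q)
    where
    p3≡ : p3 n ≡ 3 * (q * q)
    p3≡ = trans (p3-by-parity 0 0 q n≡ z<s z<s) (∑-arithmetic-pair 1 2 q q _ (closed q))
      where
      closed : ∀ q → 2 * (3 * (q * q)) + 3 * q + 3 * q ≡ 2 * 1 * q + 3 * (q * q) + (2 * 2 * q + 3 * (q * q))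
      closed = solve-∀
    m∣q : m ∣ q
    m∣q with euclidsLemma 3 (q * q) m-prime (subst (m ∣_) p3≡ m∣p3)
    ... | inj₁ m∣3  = ⊥-elim (m∤3 m∣3)
    ... | inj₂ m∣q² with euclidsLemma q q m-prime m∣q²
    ...   | inj₁ m∣q = m∣q
    ...   | inj₂ m∣q = m∣q

  ρ≡0-odd-impossible : ∀ {n} q → n ≡ 0 + 3 * (1 + 2 * q) → ¬ m ∣ p3 n
  ρ≡0-odd-impossible {n} q n≡ m∣p3 = prime∤3q[q+1]+1 {w = w} m-prime m≡ q (subst (m ∣_) p3≡ m∣p3)
    where
    p3≡ : p3 n ≡ 3 * (q * suc q) + 1
    p3≡ = trans (p3-by-parity 0 1 q n≡ z<s (s<s z<s)) (∑-arithmetic-pair 1 2 (1 + q) q _ (closed q))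
      where
      closed : ∀ q → 2 * (3 * (q * suc q) + 1) + 3 * (1 + q) + 3 * q ≡ 2 * 1 * (1 + q) + 3 * ((1 + q) * (1 + q)) + (2 * 2 * q + 3 * (q * q))
      closed = solve-∀

  balanced-0<ρ : ∀ {n ρ} e q → 0 < ρ → ρ < 3 → e < 2 → n ≡ ρ + 3 * (e + 2 * q) → m ∣ p3 n → Balanced m ρ (e + 2 * q)
  balanced-0<ρ {n} {ρ} e q 0<ρ ρ<3 e<2 n≡ m∣p3 with small-halves 0<ρ ρ<3
  ... | a₀≡ , a₁≡ , l₀≡ , l₁≡ = balanced-by-parity m ρ e q e<2 evens (λ t → cong (λ s → P s q t) l₁≡)
    where
    p3≡ : p3 n ≡ (e + q) * (ρ + 3 * q)
    p3≡ = trans (p3-by-parity ρ e q n≡ ρ<3 e<2)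
      (trans (cong₂ _+_ (∑-cong (e + q) (λ l _ → cong (_+ 3 * l) a₀≡)) (∑-cong q (λ l _ → cong (_+ 3 * l) a₁≡)))
             (∑-arithmetic-pair ρ 3 (e + q) q _ (closed e e<2)))
      where
      closed : ∀ e → e < 2 → 2 * ((e + q) * (ρ + 3 * q)) + 3 * (e + q) + 3 * q
                           ≡ 2 * ρ * (e + q) + 3 * ((e + q) * (e + q)) + (2 * 3 * q + 3 * (q * q))
      closed 0 _ = closed₀ ρ q
        where
        closed₀ : ∀ ρ q → 2 * (q * (ρ + 3 * q)) + 3 * q + 3 * q ≡ 2 * ρ * q + 3 * (q * q) + (2 * 3 * q + 3 * (q * q))
        closed₀ = solve-∀
      closed 1 _ = closed₁ ρ q
        where
        closed₁ : ∀ ρ q → 2 * ((1 + q) * (ρ + 3 * q)) + 3 * (1 + q) + 3 * q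
                        ≡ 2 * ρ * (1 + q) + 3 * ((1 + q) * (1 + q)) + (2 * 3 * q + 3 * (q * q))
        closed₁ = solve-∀
      closed (suc (suc _)) (s<s (s<s ()))
    evens : ∀ t → P ⌈ ρ /2⌉ (e + q) t ≡ P (suc ρ + 3 * q) (e + q) t
    evens t with euclidsLemma (e + q) (ρ + 3 * q) m-prime (subst (m ∣_) p3≡ m∣p3)
    ... | inj₁ m∣e+q = trans (cong (λ s → P s (e + q) t) l₀≡) (start-free (e + q) 1 (suc ρ + 3 * q) t m∣e+q)
    ... | inj₂ (divides c ρ+3q≡) = trans (cong (λ s → P s (e + q) t) l₀≡)
      (sym (trans (cong (λ s → P (suc s) (e + q) t) ρ+3q≡) (progression-shift m 3 1 c (e + q) t)))

  m∣p3⇒balanced : ∀ {n} ρ e q → ρ < 3 → e < 2 → n ≡ ρ + 3 * (e + 2 * q) → m ∣ p3 n → Balanced m ρ (e + 2 * q)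
  m∣p3⇒balanced 0       0             q _   _                n≡ m∣p3 = balanced-ρ≡0-even q n≡ m∣p3
  m∣p3⇒balanced 0       1             q _   _                n≡ m∣p3 = ⊥-elim (ρ≡0-odd-impossible q n≡ m∣p3)
  m∣p3⇒balanced 0       (suc (suc _)) q _   (s<s (s<s ()))   _  _
  m∣p3⇒balanced (suc ρ) e             q ρ<3 e<2              n≡ m∣p3 = balanced-0<ρ e q z<s ρ<3 e<2 n≡ m∣p3

theorem1 : (j : ℕ) → 0 < j → (m : ℕ) → .{{_ : NonZero m}} → m ≡ 6 * j ∸ 1 → Prime m →
    (n : ℕ) → m ∣ p3 n → (i : ℕ) → i < m → countClass m n i ≡ p3 n / m
theorem1 (suc j) _ m m≡ m-prime n m∣p3 =
  countClass-uniform m {K = e + 2 * q} n≡ (m%n<n n 3) (m∣p3⇒balanced {w = 1 + 2 * j} m-prime m≡2+3w ρ e q (m%n<n n 3) (m%n<n K 2) n≡ m∣p3)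
  where
  ρ = n % 3
  K = n / 3
  e = K % 2
  q = K / 2
  n≡ : n ≡ ρ + 3 * (e + 2 * q)
  n≡ = trans (m≡m%n+[m/n]*n n 3) (trans (cong (λ k → ρ + k * 3) (m≡m%n+[m/n]*n K 2)) (regroup ρ e q))
    where
    regroup : ∀ ρ e q → ρ + (e + q * 2) * 3 ≡ ρ + 3 * (e + 2 * q)
    regroup = solve-∀
  m≡2+3w : m ≡ 2 + 3 * (1 + 2 * j)
  m≡2+3w = trans m≡ (regroup j)
    where
    regroup : ∀ j → j + 5 * suc j ≡ 2 + 3 * (1 + 2 * j)
    regroup = solve-∀
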